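{- For all non-negative integers $r,d,b$, the bicircular matroid $B(G_1(r,d,b))$ is a lattice path matroid having an interval ordering whose minimum element is a red edge and whose maximum element is a blue edge.
   Context: $G_1(r,d,b)$ is the graph on vertices $x_0,x_1,x_2,x_3$ with one edge $x_2x_3$, one edge $x_0x_1$, $r+2$ parallel edges $x_0x_2$ (the red edges), $b+2$ parallel edges $x_1x_3$ (the blue edges), and $d$ parallel edges $x_0x_3$. $B(G)$ is the bicircular matroid: the matroid on $E(G)$ whose independent sets are edge sets $I$ such that each component of the subgraph formed by $I$ has at most one cycle (loops and parallel pairs count as cycles). A lattice path matroid is a matroid $M$ on $E$ for which there is a linear ordering of $E$ (an interval ordering) and a sequence of intervals of that ordering, pairwise incomparable under inclusion, such that $M$ is isomorphic to the transversal matroid presented by these intervals. -}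

module Defs where

open import Data.Nat using (ℕ; zero; suc; _+_)
import Data.Nat as ℕ
open import Data.Fin using (Fin; zero; suc; inject₁; fromℕ)
import Data.Fin as F
open import Data.Bool using (Bool; true)
open import Data.Product using (Σ; ∃; ∃₂; _×_; _,_)
open import Data.Sum using (_⊎_)
open import Relation.Binary.PropositionalEquality using (_≡_; _≢_)
open import Relation.Nullary using (¬_)
open import Function.Bundles using (_⇔_; _⤖_; Bijection)

EdgeSet : Set → Set
EdgeSet E = E → Bool

module Graph {V E : Set} (ends : E → V × V) where

  Joins : E → V → V → Set
  Joins e x y = (ends e ≡ (x , y)) ⊎ (ends e ≡ (y , x))

  -- A cycle of the subgraph formed by I: a closed walk
  -- vtx 0, edg 0, vtx 1, ..., edg (len-1), vtx len = vtx 0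
  -- with pairwise distinct vertices vtx 0 .. vtx (len-1) and pairwise
  -- distinct edges, all in I.  (len = 1: a loop; len = 2: a parallel pair.)
  record Cycle (I : EdgeSet E) : Set where
    field
      len      : ℕ
      len≥1    : 1 ℕ.≤ len
      vtx      : Fin (suc len) → V
      edg      : Fin len → E
      closed   : vtx zero ≡ vtx (fromℕ len)
      vtx-inj  : ∀ i j → vtx (inject₁ i) ≡ vtx (inject₁ j) → i ≡ j
      edg-inj  : ∀ i j → edg i ≡ edg j → i ≡ j
      edg-in   : ∀ i → I (edg i) ≡ true
      edg-join : ∀ i → Joins (edg i) (vtx (inject₁ i)) (vtx (suc i))

  open Cycle public

  EdgeOf : ∀ {I} → Cycle I → E → Set
  EdgeOf C e = ∃ λ i → edg C i ≡ e

  VertexOf : ∀ {I} → Cycle I → V → Set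
  VertexOf C v = ∃ λ i → vtx C i ≡ v

  data Reach (I : EdgeSet E) : V → V → Set where
    here : ∀ {u} → Reach I u u
    step : ∀ {u w v} (e : E) → I e ≡ true → Joins e u w → Reach I w v → Reach I u v

  SameComponent : ∀ {I} → Cycle I → Cycle I → Set
  SameComponent {I} C D = ∃₂ λ u v → VertexOf C u × VertexOf D v × Reach I u v

  -- Bicircular independence: every component of the subgraph formed by I
  -- has at most one cycle (cycles identified by their edge sets).
  BicircularIndep : EdgeSet E → Set
  BicircularIndep I =
    (C D : Cycle I) → SameComponent C D → ∀ e → EdgeOf C e ⇔ EdgeOf D e

-- Transversal matroid presented by intervals of a linear order.

module Intervals {E : Set} {n : ℕ} (pos : E → Fin n) {k : ℕ} (lo hi : Fin k → Fin n) where

  InInterval : Fin k → Fin n → Set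
  InInterval i p = (lo i F.≤ p) × (p F.≤ hi i)

  ValidPresentation : Set
  ValidPresentation =
    (∀ i → lo i F.≤ hi i) ×
    (∀ i j → i ≢ j → ¬ (∀ p → InInterval i p → InInterval j p))

  TransversalIndep : EdgeSet E → Set
  TransversalIndep I =
    Σ ((e : E) → I e ≡ true → Fin k) λ f →
      (∀ e e' (p : I e ≡ true) (p' : I e' ≡ true) → f e p ≡ f e' p' → e ≡ e') ×
      (∀ e (p : I e ≡ true) → InInterval (f e p) (pos e))

data Edge (r d b : ℕ) : Set where
  e01  : Edge r d b
  e23  : Edge r d b
  red  : Fin (2 + r) → Edge r d b
  blue : Fin (2 + b) → Edge r d b
  dia  : Fin d → Edge r d b

x0 x1 x2 x3 : Fin 4
x0 = zero
x1 = suc zero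
x2 = suc (suc zero)
x3 = suc (suc (suc zero))

ends : ∀ {r d b} → Edge r d b → Fin 4 × Fin 4
ends e01      = x0 , x1
ends e23      = x2 , x3
ends (red _)  = x0 , x2
ends (blue _) = x1 , x3
ends (dia _)  = x0 , x3

IsRed IsBlue : ∀ {r d b} → Edge r d b → Set
IsRed  {r} e = ∃ λ (i : Fin (2 + r)) → e ≡ red i
IsBlue {b = b} e = ∃ λ (i : Fin (2 + b)) → e ≡ blue i

nEdges : ℕ → ℕ → ℕ → ℕ
nEdges r d b = 6 + r + d + b

LatticePathWithRedMinBlueMax : (r d b : ℕ) → Set
LatticePathWithRedMinBlueMax r d b =
  Σ (Edge r d b ⤖ Fin (nEdges r d b)) λ ord →
  Σ ℕ λ k →
  Σ (Fin k → Fin (nEdges r d b)) λ lo →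
  Σ (Fin k → Fin (nEdges r d b)) λ hi →
    Intervals.ValidPresentation (Bijection.to ord) lo hi ×
    (∀ (I : EdgeSet (Edge r d b)) →
       Graph.BicircularIndep ends I ⇔ Intervals.TransversalIndep (Bijection.to ord) lo hi I) ×
    (∀ e → Bijection.to ord e ≡ zero → IsRed e) ×
    (∀ e → Bijection.to ord e ≡ fromℕ (5 + r + d + b) → IsBlue e)

-- B(G) is the transversal matroid of the vertex stars: an edge set is bicircular-independent iff
-- its edges can be assigned injectively to incident vertices.  One half holds in every graph: under
-- such an orientation every cycle is directed and absorbs each edge pointing into one of its
-- vertices, so two cycles in one component meet and then coincide.
--
-- Order G₁(r,d,b) as reds, e₂₃, diagonals, e₀₁, blues and present it by the intervals
-- [red₀, e₂₃], [red₁, e₀₁], [e₂₃, penultimate blue], [e₀₁, last blue].  These are the stars of x₂,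
-- x₀, x₃, x₁, except that red₀ is traded for e₂₃ in the second and the last blue edge for e₀₁ in
-- the third; so a matching into stars becomes one into intervals, and back, by exchanging the
-- contents of two slots at a time.
--
-- For the other half on G₁(r,d,b): an independent set has at most two edges of each colour (three
-- parallel edges form a bicycle), so it is the image of a subset of G₁(1,3,1) described by a profile
-- of counts.  By evaluation, each of the 256 profiles either has an orientation found by search or
-- contains one of seventeen explicit bicycles.

module Submission where

open import Defs
open import Axiom.UniquenessOfIdentityProofs using (module Decidable⇒UIP)
open import Data.Bool as Bool using (Bool; true; false; not; T; _∧_; _∨_; if_then_else_)
open import Data.Bool.Properties using (T-≡; T-not-≡; T-∨; T-∧)
open import Data.Empty using (⊥; ⊥-elim)
open import Data.Fin as F using (Fin; zero; suc; inject₁; fromℕ; toℕ; _↑ˡ_; _↑ʳ_; splitAt)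
open import Data.Fin.Induction using (<-weakInduction; >-weakInduction)
open import Data.Fin.Patterns using (0F; 1F; 2F; 3F)
import Data.Fin.Properties as F
open import Data.List as List using (List; _∷_; [])
open import Data.List.Membership.Propositional using (_∈_)
open import Data.List.Membership.Propositional.Properties using (∈-map⁺; ∈-allFin)
open import Data.List.Relation.Unary.All using (All; _∷_; []; lookupAny)
open import Data.List.Relation.Unary.Any as Any using (Any; here; there)
open import Data.Maybe as Maybe using (Maybe; just; nothing; _<∣>_; _>>=_)
open import Data.Maybe.Properties using (just-injective)
open import Data.Nat as ℕ using (ℕ; zero; suc; _+_)
import Data.Nat.Properties as ℕ
open import Data.Nat.Tactic.RingSolver using (solve-∀)
open import Data.Product using (Σ; ∃; _×_; _,_; proj₁; proj₂; map₂)
open import Data.Product.Properties using () renaming (≡-dec to ×-≡-dec)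
open import Data.Sum as Sum using (_⊎_; inj₁; inj₂; [_,_])
open import Data.Vec as Vec using (Vec; _∷_; [])
open import Function using (_∘_; case_of_)
open import Function.Bundles using (_⇔_; mk⇔; Equivalence; _⤖_; Bijection; mk↔ₛ′)
open import Function.Properties.Inverse using (↔⇒⤖)
open import Relation.Binary.Definitions using (DecidableEquality)
open import Relation.Binary.PropositionalEquality hiding ([_])
open import Relation.Nullary using (¬_; ¬?; Dec; yes; no; does)
import Relation.Nullary.Decidable as Dec
open import Relation.Nullary.Decidable using (True; isYes; toWitness; fromWitness; T?; _×-dec_; _⊎-dec_; _→-dec_)

-- A matching of I into a family (Allowed a)ₐ, seen from the elements (Matching) or from the
-- indices (Cover).
module _ {E A : Set} where

  Matching : EdgeSet E → (A → E → Set) → Set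
  Matching I Allowed =
    Σ ((e : E) → I e ≡ true → A) λ f →
      (∀ e e' (p : I e ≡ true) (p' : I e' ≡ true) → f e p ≡ f e' p' → e ≡ e') ×
      (∀ e (p : I e ≡ true) → Allowed (f e p) e)

  record Cover (I : EdgeSet E) (Allowed : A → E → Set) : Set where
    field
      pick         : A → Maybe E
      pick-in      : ∀ {a e} → pick a ≡ just e → I e ≡ true
      pick-allowed : ∀ {a e} → pick a ≡ just e → Allowed a e
      covers       : ∀ {e} → I e ≡ true → ∃ λ a → pick a ≡ just e

  module _ {I : EdgeSet E} {Allowed : A → E → Set} where

    cover⇒matching : Cover I Allowed → Matching I Allowed
    cover⇒matching cov =
      (λ e p → proj₁ (covers p)) ,
      (λ e e' p p' eq → just-injective (trans (sym (proj₂ (covers p)))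
                                         (trans (cong pick eq) (proj₂ (covers p'))))) ,
      (λ e p → pick-allowed (proj₂ (covers p)))
      where open Cover cov

    matching⇒cover : ∀ {n} (enum : Fin n → E) → (∀ e → ∃ λ k → enum k ≡ e) →
                     DecidableEquality A → Matching I Allowed → Cover I Allowed
    matching⇒cover {n} enum enum-onto _≟_ (f , f-inj , f-allowed) = record
      { pick = pick ; pick-in = pick-in ; pick-allowed = pick-allowed ; covers = covers }
      where
        Hit : A → Fin n → Set
        Hit a k = Σ (I (enum k) ≡ true) λ p → f (enum k) p ≡ a

        hit? : ∀ a k → Dec (Hit a k)
        hit? a k with I (enum k) Bool.≟ true
        ... | no ¬p = no (¬p ∘ proj₁)
        ... | yes p with f (enum k) p ≟ a
        ...   | yes q = yes (p , q)
        ...   | no ¬q = no λ { (p' , q) → ¬q (subst (λ p → f (enum k) p ≡ a) (Decidable⇒UIP.≡-irrelevant Bool._≟_ p' p) q) }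

        found : ∀ {a} → Dec (∃ (Hit a)) → Maybe E
        found (yes (k , _)) = just (enum k)
        found (no _) = nothing

        pick : A → Maybe E
        pick a = found (F.any? (hit? a))

        found-hit : ∀ {a e} (h : Dec (∃ (Hit a))) → found h ≡ just e → Σ (I e ≡ true) λ p → f e p ≡ a
        found-hit (yes (k , p , q)) refl = p , q

        pick-in : ∀ {a e} → pick a ≡ just e → I e ≡ true
        pick-in eq = proj₁ (found-hit (F.any? _) eq)

        pick-allowed : ∀ {a e} → pick a ≡ just e → Allowed a e
        pick-allowed {a} {e} eq with found-hit (F.any? _) eq
        ... | p , refl = f-allowed e p

        covers : ∀ {e} → I e ≡ true → ∃ λ a → pick a ≡ just e
        covers {e} p = f e p , finds-e (F.any? (hit? (f e p)))
          where
            finds-e : (h : Dec (∃ (Hit (f e p)))) → found h ≡ just e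
            finds-e (yes (k , p' , q)) = cong just (f-inj _ _ p' p q)
            finds-e (no none) with enum-onto e
            ... | k , refl = ⊥-elim (none (k , p , refl))

top-or-inject₁ : ∀ {n} (i : Fin (suc n)) → i ≡ fromℕ n ⊎ ∃ λ j → i ≡ inject₁ j
top-or-inject₁ {zero}  zero    = inj₁ refl
top-or-inject₁ {suc n} zero    = inj₂ (zero , refl)
top-or-inject₁ {suc n} (suc i) with top-or-inject₁ i
... | inj₁ eq       = inj₁ (cong suc eq)
... | inj₂ (j , eq) = inj₂ (suc j , cong suc eq)

suc≢inject₁ : ∀ {n} (j : Fin n) → suc j ≢ inject₁ j
suc≢inject₁ j eq = ℕ.1+n≢n (trans (cong toℕ eq) (F.toℕ-inject₁ j))

isLast : ∀ {n} → Fin (suc n) → Bool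
isLast {zero}  _       = true
isLast {suc n} zero    = false
isLast {suc n} (suc k) = isLast k

isLast-fromℕ : ∀ n → isLast (fromℕ n) ≡ true
isLast-fromℕ zero    = refl
isLast-fromℕ (suc n) = isLast-fromℕ n

isLast-inject₁ : ∀ {n} (k : Fin n) → isLast (inject₁ k) ≡ false
isLast-inject₁ {suc n} zero    = refl
isLast-inject₁ {suc n} (suc k) = isLast-inject₁ k

isLast⇒≡fromℕ : ∀ {n} (k : Fin (suc n)) → isLast k ≡ true → k ≡ fromℕ n
isLast⇒≡fromℕ {zero}  zero    _  = refl
isLast⇒≡fromℕ {suc n} (suc k) eq = cong suc (isLast⇒≡fromℕ k eq)

¬isLast⇒toℕ< : ∀ {n} (k : Fin (suc n)) → isLast k ≡ false → toℕ k ℕ.< n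
¬isLast⇒toℕ< {suc n} zero    _  = ℕ.s≤s ℕ.z≤n
¬isLast⇒toℕ< {suc n} (suc k) eq = ℕ.s≤s (¬isLast⇒toℕ< k eq)

data Few {m} (P : Fin m → Bool) : Set where
  none  : (∀ {k} → P k ≡ true → ⊥) → Few P
  one   : ∀ {i} → P i ≡ true → (∀ {k} → P k ≡ true → k ≡ i) → Few P
  two   : ∀ {i j} → i ≢ j → P i ≡ true → P j ≡ true → (∀ {k} → P k ≡ true → k ≡ i ⊎ k ≡ j) → Few P
  three : ∀ {i j k} → i ≢ j → i ≢ k → j ≢ k → P i ≡ true → P j ≡ true → P k ≡ true → Few P

few : ∀ {m} (P : Fin m → Bool) → Few P
few {zero}  P = none λ { {()} }
few {suc m} P with few (P ∘ suc) | P zero in p₀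
... | none h             | false = none λ { {zero} p → true≢false p ; {suc k} p → h p }
  where true≢false = λ p → case trans (sym p) p₀ of λ ()
... | none h             | true  = one p₀ λ { {zero} _ → refl ; {suc k} p → ⊥-elim (h p) }
... | one pᵢ h           | false = one pᵢ λ { {zero} p → case trans (sym p) p₀ of λ () ; {suc k} p → cong suc (h p) }
... | one pᵢ h           | true  = two (λ ()) p₀ pᵢ λ { {zero} _ → inj₁ refl ; {suc k} p → inj₂ (cong suc (h p)) }
... | two i≢j pᵢ pⱼ h    | false = two (i≢j ∘ F.suc-injective) pᵢ pⱼ
                                       λ { {zero} p → case trans (sym p) p₀ of λ () ; {suc k} p → Sum.map (cong suc) (cong suc) (h p) }
... | two i≢j pᵢ pⱼ h    | true  = three (λ ()) (λ ()) (i≢j ∘ F.suc-injective) p₀ pᵢ pⱼ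
... | three i≢j i≢k j≢k pᵢ pⱼ pₖ | _ = three (i≢j ∘ F.suc-injective) (i≢k ∘ F.suc-injective) (j≢k ∘ F.suc-injective) pᵢ pⱼ pₖ

module _ {m} {P : Fin m → Bool} where

  count : Few P → Fin 4
  count (none _)            = 0F
  count (one _ _)           = 1F
  count (two _ _ _ _)       = 2F
  count (three _ _ _ _ _ _) = 3F

  members : Few P → Fin 3 → Maybe (Fin m)
  members (none _)                                0F = nothing
  members (one {i} _ _)                           0F = just i
  members (two {i} _ _ _ _)                       0F = just i
  members (two {j = j} _ _ _ _)                   1F = just j
  members (three {i} _ _ _ _ _ _)                 0F = just i
  members (three {j = j} _ _ _ _ _ _)             1F = just j
  members (three {k = k} _ _ _ _ _ _)             2F = just k
  members _                                       _  = nothing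

  members-present : ∀ f k → toℕ k ℕ.< toℕ (count f) → ∃ λ i → members f k ≡ just i
  members-present (one _ _)           0F _ = _ , refl
  members-present (two _ _ _ _)       0F _ = _ , refl
  members-present (two _ _ _ _)       1F _ = _ , refl
  members-present (three _ _ _ _ _ _) 0F _ = _ , refl
  members-present (three _ _ _ _ _ _) 1F _ = _ , refl
  members-present (three _ _ _ _ _ _) 2F _ = _ , refl
  members-present (one _ _)           (suc _)       (ℕ.s≤s ())
  members-present (two _ _ _ _)       (suc (suc _)) (ℕ.s≤s (ℕ.s≤s ()))

  members-in : ∀ f {k i} → members f k ≡ just i → P i ≡ true
  members-in (one p _)               {0F} refl = p
  members-in (two _ p _ _)           {0F} refl = p
  members-in (two _ _ p _)           {1F} refl = p
  members-in (three _ _ _ p _ _)     {0F} refl = p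
  members-in (three _ _ _ _ p _)     {1F} refl = p
  members-in (three _ _ _ _ _ p)     {2F} refl = p

  index : Few P → Fin m → Fin 3
  index (two {i} _ _ _ _)            x = if does (x F.≟ i) then 0F else 1F
  index (three {i} {j} _ _ _ _ _ _)  x = if does (x F.≟ i) then 0F else if does (x F.≟ j) then 1F else 2F
  index _                            _ = 0F

  index-members : ∀ f {k i} → members f k ≡ just i → index f i ≡ k
  index-members (one _ _)                 {0F} refl = refl
  index-members (two {i} _ _ _ _)         {0F} refl with i F.≟ i
  ... | yes _   = refl
  ... | no i≢i = ⊥-elim (i≢i refl)
  index-members (two {i} {j} i≢j _ _ _)   {1F} refl with j F.≟ i
  ... | yes j≡i = ⊥-elim (i≢j (sym j≡i))
  ... | no _    = refl
  index-members (three {i} _ _ _ _ _ _)   {0F} refl with i F.≟ i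
  ... | yes _   = refl
  ... | no i≢i = ⊥-elim (i≢i refl)
  index-members (three {i} {j} i≢j _ _ _ _ _) {1F} refl with j F.≟ i | j F.≟ j
  ... | yes j≡i | _       = ⊥-elim (i≢j (sym j≡i))
  ... | no _    | yes _   = refl
  ... | no _    | no j≢j = ⊥-elim (j≢j refl)
  index-members (three {i} {j} {k} _ i≢k j≢k _ _ _) {2F} refl with k F.≟ i | k F.≟ j
  ... | yes k≡i | _       = ⊥-elim (i≢k (sym k≡i))
  ... | no _    | yes k≡j = ⊥-elim (j≢k (sym k≡j))
  ... | no _    | no _    = refl

  members-complete : ∀ f → toℕ (count f) ℕ.≤ 2 → ∀ {i} → P i ≡ true →
                     ∃ λ k → toℕ k ℕ.< toℕ (count f) × members f k ≡ just i
  members-complete (none h)      _ p = ⊥-elim (h p)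
  members-complete (one _ h)     _ p = 0F , ℕ.s≤s ℕ.z≤n , cong just (sym (h p))
  members-complete (two _ _ _ h) _ p with h p
  ... | inj₁ refl = 0F , ℕ.s≤s ℕ.z≤n , refl
  ... | inj₂ refl = 1F , ℕ.s≤s (ℕ.s≤s ℕ.z≤n) , refl
  members-complete (three _ _ _ _ _ _) (ℕ.s≤s (ℕ.s≤s ()))

module ClosedWalk {V : Set} {L : ℕ} (vt : Fin (suc (suc L)) → V) (closed : vt zero ≡ vt (fromℕ (suc L)))
                  (h : Fin (suc L) → V) (h-injective : ∀ {j j'} → h j ≡ h j' → j ≡ j')
                  (h-end : ∀ j → h j ≡ vt (inject₁ j) ⊎ h j ≡ vt (suc j)) where

  directed : (∀ j → h j ≡ vt (suc j)) ⊎ (∀ j → h j ≡ vt (inject₁ j))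
  directed with h-end zero
  ... | inj₂ h₀ = inj₁ (<-weakInduction (λ j → h j ≡ vt (suc j)) h₀ forward)
    where
      forward : ∀ j → h (inject₁ j) ≡ vt (suc (inject₁ j)) → h (suc j) ≡ vt (suc (suc j))
      forward j hj with h-end (suc j)
      ... | inj₂ fwd = fwd
      ... | inj₁ bwd = ⊥-elim (suc≢inject₁ j (h-injective (trans bwd (sym hj))))
  ... | inj₁ h₀ = inj₂ (>-weakInduction (λ j → h j ≡ vt (inject₁ j)) last backward)
    where
      last : h (fromℕ L) ≡ vt (inject₁ (fromℕ L))
      last with h-end (fromℕ L)
      ... | inj₁ bwd = bwd
      ... | inj₂ fwd = subst (λ j → h j ≡ vt (inject₁ j)) (h-injective (trans h₀ (trans closed (sym fwd)))) h₀
      backward : ∀ j → h (suc j) ≡ vt (inject₁ (suc j)) → h (inject₁ j) ≡ vt (inject₁ (inject₁ j))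
      backward j hj with h-end (inject₁ j)
      ... | inj₁ bwd = bwd
      ... | inj₂ fwd = ⊥-elim (suc≢inject₁ j (h-injective (trans hj (sym fwd))))

  saturated : ∀ i → ∃ λ j → h j ≡ vt i
  saturated i with directed
  saturated zero    | inj₁ fwd = fromℕ L , trans (fwd (fromℕ L)) (sym closed)
  saturated (suc j) | inj₁ fwd = j , fwd j
  saturated i       | inj₂ bwd with top-or-inject₁ i
  ... | inj₁ refl       = zero , trans (bwd zero) closed
  ... | inj₂ (j , refl) = j , bwd j

  propagate : (P : V → Set) → (∀ j → P (h j) → P (vt (inject₁ j)) × P (vt (suc j))) →
              ∀ m → P (vt m) → ∀ i → P (vt i)
  propagate P step m pm with directed
  ... | inj₁ fwd = >-weakInduction (P ∘ vt) (subst P closed p₀) down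
    where
      down : ∀ j → P (vt (suc j)) → P (vt (inject₁ j))
      down j p = proj₁ (step j (subst P (sym (fwd j)) p))
      p₀ = <-weakInduction (λ i → P (vt i) → P (vt zero)) (λ p → p) (λ j next p → next (down j p)) m pm
  ... | inj₂ bwd = <-weakInduction (P ∘ vt) (subst P (sym closed) pₗ) up
    where
      up : ∀ j → P (vt (inject₁ j)) → P (vt (suc j))
      up j p = proj₂ (step j (subst P (sym (bwd j)) p))
      pₗ = >-weakInduction (λ i → P (vt i) → P (vt (fromℕ (suc L)))) (λ p → p) (λ j next p → next (up j p)) m pm

module Bicircular {V E : Set} (ends : E → V × V) where

  open Graph ends

  Endpoint : V → E → Set
  Endpoint v e = v ≡ proj₁ (ends e) ⊎ v ≡ proj₂ (ends e)

  endpoint? : DecidableEquality V → ∀ v e → Dec (Endpoint v e)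
  endpoint? _≟_ v e = v ≟ proj₁ (ends e) ⊎-dec v ≟ proj₂ (ends e)

  joins-endpoint : ∀ {e x y v} → Joins e x y → Endpoint v e → v ≡ x ⊎ v ≡ y
  joins-endpoint (inj₁ refl) (inj₁ refl) = inj₁ refl
  joins-endpoint (inj₁ refl) (inj₂ refl) = inj₂ refl
  joins-endpoint (inj₂ refl) (inj₁ refl) = inj₂ refl
  joins-endpoint (inj₂ refl) (inj₂ refl) = inj₁ refl

  joins-other : ∀ {e x y u w} → Joins e x y → Joins e u w → w ≡ x ⊎ w ≡ y
  joins-other j (inj₁ refl) = joins-endpoint j (inj₂ refl)
  joins-other j (inj₂ refl) = joins-endpoint j (inj₁ refl)

  joins-back : ∀ {e x y w} → Joins e x y → Joins e y w → w ≡ x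
  joins-back (inj₁ refl) (inj₁ eq)   = sym (trans (cong proj₁ eq) (cong proj₂ eq))
  joins-back (inj₁ refl) (inj₂ refl) = refl
  joins-back (inj₂ refl) (inj₁ refl) = refl
  joins-back (inj₂ refl) (inj₂ eq)   = sym (trans (cong proj₂ eq) (cong proj₁ eq))

  joins-sym : ∀ {e x y} → Joins e x y → Joins e y x
  joins-sym (inj₁ eq) = inj₂ eq
  joins-sym (inj₂ eq) = inj₁ eq

  Orientation : EdgeSet E → Set
  Orientation I = Matching I Endpoint

  module _ {I : EdgeSet E} (orientation : Orientation I) where

    private
      head : ∀ e → I e ≡ true → V
      head = proj₁ orientation

      head-injective : ∀ {e e'} (p : I e ≡ true) (p' : I e' ≡ true) → head e p ≡ head e' p' → e ≡ e'
      head-injective = proj₁ (proj₂ orientation) _ _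

      head-endpoint : ∀ e (p : I e ≡ true) → Endpoint (head e p) e
      head-endpoint = proj₂ (proj₂ orientation)

    private
      hd : (C : Cycle I) → Fin (len C) → V
      hd C j = head (edg C j) (edg-in C j)

      hd-injective : (C : Cycle I) → ∀ {j j'} → hd C j ≡ hd C j' → j ≡ j'
      hd-injective C eq = edg-inj C _ _ (head-injective _ _ eq)

      hd-end : (C : Cycle I) → ∀ j → hd C j ≡ vtx C (inject₁ j) ⊎ hd C j ≡ vtx C (suc j)
      hd-end C j = joins-endpoint (edg-join C j) (head-endpoint _ _)

    cycle-saturated : (C : Cycle I) → ∀ i → ∃ λ j → hd C j ≡ vtx C i
    cycle-saturated C@record { len = suc L } = ClosedWalk.saturated (vtx C) (closed C) (hd C) (hd-injective C) (hd-end C)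
    cycle-saturated record { len = zero ; len≥1 = () }

    cycle-propagate : (C : Cycle I) (P : V → Set) →
                      (∀ j → P (hd C j) → P (vtx C (inject₁ j)) × P (vtx C (suc j))) →
                      ∀ m → P (vtx C m) → ∀ i → P (vtx C i)
    cycle-propagate C@record { len = suc L } P =
      ClosedWalk.propagate (vtx C) (closed C) (hd C) (hd-injective C) (hd-end C) P
    cycle-propagate record { len = zero ; len≥1 = () }

    absorbed : (C : Cycle I) → ∀ {e} (p : I e ≡ true) → VertexOf C (head e p) → EdgeOf C e
    absorbed C p (i , eq) with cycle-saturated C i
    ... | j , hj = j , head-injective _ p (trans hj eq)

    edge-ends : (C : Cycle I) → ∀ {e x w} → EdgeOf C e → Joins e x w → VertexOf C w
    edge-ends C (j , refl) J with joins-other (edg-join C j) J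
    ... | inj₁ eq = inject₁ j , sym eq
    ... | inj₂ eq = suc j , sym eq

    shared⇒vertices : (C D : Cycle I) → ∀ {w} → VertexOf C w → VertexOf D w → ∀ i → VertexOf D (vtx C i)
    shared⇒vertices C D (m , refl) wD = cycle-propagate C (VertexOf D) closure m wD
      where
        closure : ∀ j → VertexOf D (hd C j) → VertexOf D (vtx C (inject₁ j)) × VertexOf D (vtx C (suc j))
        closure j p = edge-ends D (absorbed D _ p) (joins-sym (edg-join C j)) , edge-ends D (absorbed D _ p) (edg-join C j)

    shared⇒contained : (C D : Cycle I) → ∀ {w} → VertexOf C w → VertexOf D w → ∀ {e} → EdgeOf C e → EdgeOf D e
    shared⇒contained C D wC wD (j , refl) = absorbed D _ (head-in-D (hd-end C j))
      where
        head-in-D : hd C j ≡ vtx C (inject₁ j) ⊎ hd C j ≡ vtx C (suc j) → VertexOf D (hd C j)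
        head-in-D (inj₁ eq) = subst (VertexOf D) (sym eq) (shared⇒vertices C D wC wD _)
        head-in-D (inj₂ eq) = subst (VertexOf D) (sym eq) (shared⇒vertices C D wC wD _)

    data Outward (C : Cycle I) : V → Set where
      on-cycle : ∀ {x} → VertexOf C x → Outward C x
      away     : ∀ {e y x} (p : I e ≡ true) → Joins e y x → head e p ≡ x → Outward C y → Outward C x

    outward-walk : ∀ {C x v} → Outward C x → Reach I x v → Outward C v
    outward-walk o here = o
    outward-walk {C} {x} o (step {w = w} e p J r) with joins-endpoint J (head-endpoint e p)
    ... | inj₂ into-w = outward-walk (away p J into-w o) r
    ... | inj₁ into-x = outward-walk (back o into-x) r
      where
        back : Outward C x → head e p ≡ x → Outward C w
        back (on-cycle xC) into-x = on-cycle (edge-ends C (absorbed C p (subst (VertexOf C) (sym into-x) xC)) J)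
        back (away p' J' into-x' o') into-x with head-injective p p' (trans into-x (sym into-x'))
        ... | refl = subst (Outward C) (sym (joins-back J' J)) o'

    outward-meet : ∀ {C D x} → Outward C x → VertexOf D x → ∃ λ w → VertexOf C w × VertexOf D w
    outward-meet (on-cycle xC) xD = _ , xC , xD
    outward-meet {C} {D} (away p J into-x o) xD =
      outward-meet {C} {D} o (edge-ends D (absorbed D p (subst (VertexOf D) (sym into-x) xD)) (joins-sym J))

    orientation⇒bicircular : BicircularIndep I
    orientation⇒bicircular C D (u , v , uC , vD , r) e with outward-meet {C} {D} (outward-walk (on-cycle uC) r) vD
    ... | w , wC , wD = mk⇔ (shared⇒contained C D wC wD) (shared⇒contained D C wD wC)

  two-cycles⇒dependent : ∀ {I} (C D : Cycle I) {u v e} → VertexOf C u → VertexOf D v → Reach I u v →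
                         EdgeOf C e → ¬ EdgeOf D e → ¬ BicircularIndep I
  two-cycles⇒dependent C D uC vD r eC e∉D bic = e∉D (Equivalence.to (bic C D (_ , _ , uC , vD , r) _) eC)

  module DecidableCycles (_≟ᵥ_ : DecidableEquality V) (_≟ₑ_ : DecidableEquality E) (I : EdgeSet E) where

    IsCycle : ∀ {L} → (Fin (suc L) → V) → (Fin L → E) → Set
    IsCycle {L} vt ed =
      vt zero ≡ vt (fromℕ L) ×
      (∀ i j → vt (inject₁ i) ≡ vt (inject₁ j) → i ≡ j) ×
      (∀ i j → ed i ≡ ed j → i ≡ j) ×
      (∀ i → I (ed i) ≡ true) ×
      (∀ i → Joins (ed i) (vt (inject₁ i)) (vt (suc i)))

    isCycle? : ∀ {L} (vt : Fin (suc L) → V) (ed : Fin L → E) → Dec (IsCycle vt ed)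
    isCycle? vt ed =
      vt zero ≟ᵥ vt (fromℕ _) ×-dec
      F.all? (λ i → F.all? λ j → vt (inject₁ i) ≟ᵥ vt (inject₁ j) →-dec i F.≟ j) ×-dec
      F.all? (λ i → F.all? λ j → ed i ≟ₑ ed j →-dec i F.≟ j) ×-dec
      F.all? (λ i → I (ed i) Bool.≟ true) ×-dec
      F.all? (λ i → ends (ed i) ≟ₚ (vt (inject₁ i) , vt (suc i)) ⊎-dec ends (ed i) ≟ₚ (vt (suc i) , vt (inject₁ i)))
      where _≟ₚ_ = ×-≡-dec _≟ᵥ_ _≟ᵥ_

    cycle : ∀ {L} (vt : Fin (suc (suc L)) → V) (ed : Fin (suc L) → E) → {True (isCycle? vt ed)} → Cycle I
    cycle {L} vt ed {valid} with toWitness valid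
    ... | cl , vi , ei , ein , ej = record
      { len = suc L ; len≥1 = ℕ.s≤s ℕ.z≤n ; vtx = vt ; edg = ed ; closed = cl
      ; vtx-inj = vi ; edg-inj = ei ; edg-in = ein ; edg-join = ej }

module Embedding {V E₁ E₂ : Set} (ends₁ : E₁ → V × V) (ends₂ : E₂ → V × V) where

  private
    module Dom = Graph ends₁
    module Cod = Graph ends₂
    open Bicircular ends₁ using () renaming (Endpoint to Endpoint₁)
    open Bicircular ends₂ using () renaming (Endpoint to Endpoint₂)

  record _↪_ (J : EdgeSet E₁) (I : EdgeSet E₂) : Set where
    field
      map           : E₁ → E₂
      map-in        : ∀ {e} → J e ≡ true → I (map e) ≡ true
      map-ends      : ∀ {e} → J e ≡ true → ends₂ (map e) ≡ ends₁ e
      map-injective : ∀ {e e'} → J e ≡ true → J e' ≡ true → map e ≡ map e' → e ≡ e'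

  module _ {J : EdgeSet E₁} {I : EdgeSet E₂} (emb : J ↪ I) where

    open _↪_ emb

    private
      map-joins : ∀ {e x y} → J e ≡ true → Dom.Joins e x y → Cod.Joins (map e) x y
      map-joins p (inj₁ eq) = inj₁ (trans (map-ends p) eq)
      map-joins p (inj₂ eq) = inj₂ (trans (map-ends p) eq)

      map-cycle : Dom.Cycle J → Cod.Cycle I
      map-cycle C = record
        { len = len ; len≥1 = len≥1 ; vtx = vtx ; edg = map ∘ edg ; closed = closed ; vtx-inj = vtx-inj
        ; edg-inj = λ i j eq → edg-inj i j (map-injective (edg-in i) (edg-in j) eq)
        ; edg-in = λ i → map-in (edg-in i)
        ; edg-join = λ i → map-joins (edg-in i) (edg-join i) }
        where open Dom.Cycle C

      map-reach : ∀ {u v} → Dom.Reach J u v → Cod.Reach I u v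
      map-reach Dom.here             = Cod.here
      map-reach (Dom.step e p J r) = Cod.step (map e) (map-in p) (map-joins p J) (map-reach r)

    bicircular-reflect : Cod.BicircularIndep I → Dom.BicircularIndep J
    bicircular-reflect bic C D (u , v , uC , vD , r) e =
      mk⇔ (pull C D (Equivalence.to ∘ same)) (pull D C (Equivalence.from ∘ same))
      where
        same : ∀ x → Cod.EdgeOf (map-cycle C) x ⇔ Cod.EdgeOf (map-cycle D) x
        same = bic (map-cycle C) (map-cycle D) (u , v , uC , vD , map-reach r)

        pull : ∀ C' D' → (∀ x → Cod.EdgeOf (map-cycle C') x → Cod.EdgeOf (map-cycle D') x) →
               Dom.EdgeOf C' e → Dom.EdgeOf D' e
        pull C' D' f (i , refl) with f _ (i , refl)
        ... | j , eq = j , map-injective (Dom.edg-in D' j) (Dom.edg-in C' i) eq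

    push-cover : (∀ {e} → I e ≡ true → ∃ λ ρ → J ρ ≡ true × map ρ ≡ e) →
                 Cover J Endpoint₁ → Cover I Endpoint₂
    push-cover onto cov = record
      { pick = Maybe.map map ∘ pick
      ; pick-in = λ eq → case picked eq of λ { (ρ , pρ , refl) → map-in (pick-in pρ) }
      ; pick-allowed = λ eq → case picked eq of λ { (ρ , pρ , refl) → transport (pick-in pρ) (pick-allowed pρ) }
      ; covers = covers′ }
      where
        open Cover cov

        picked : ∀ {v e} → Maybe.map map (pick v) ≡ just e → ∃ λ ρ → pick v ≡ just ρ × map ρ ≡ e
        picked {v} eq with pick v
        picked refl | just ρ = ρ , refl , refl

        transport : ∀ {v ρ} → J ρ ≡ true → Endpoint₁ v ρ → Endpoint₂ v (map ρ)
        transport p (inj₁ eq) = inj₁ (trans eq (cong proj₁ (sym (map-ends p))))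
        transport p (inj₂ eq) = inj₂ (trans eq (cong proj₂ (sym (map-ends p))))

        covers′ : ∀ {e} → I e ≡ true → ∃ λ v → Maybe.map map (pick v) ≡ just e
        covers′ p with onto p
        ... | ρ , pρ , refl with covers pρ
        ...   | v , eq = v , cong (Maybe.map map) eq

  restrict : ∀ {K J : EdgeSet E₁} {I : EdgeSet E₂} → K ↪ I → (∀ {e} → J e ≡ true → K e ≡ true) → J ↪ I
  restrict emb J⊆K = record
    { map = map ; map-in = map-in ∘ J⊆K ; map-ends = map-ends ∘ J⊆K
    ; map-injective = λ p p' → map-injective (J⊆K p) (J⊆K p') }
    where open _↪_ emb

-- Slots a, b (admitting Pa, Pb) are emptied into slots A, B (admitting QA, QB): A takes the
-- special element if b holds it, and otherwise the content of a.
module Exchange {E : Set} (special : E → Bool) (special-unique : ∀ {e e'} → T (special e) → T (special e') → e ≡ e')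
                (Pa Pb QA QB : E → Bool)
                (a⇒A : ∀ {e} → T (Pa e) → T (QA e))
                (a⇒B : ∀ {e} → T (Pa e) → T (not (special e)) → T (QB e))
                (b⇒B : ∀ {e} → T (Pb e) → T (not (special e)) → T (QB e))
                (special⇒A : ∀ {e} → T (special e) → T (QA e)) where

  keep : (E → Bool) → Maybe E → Maybe E
  keep Q nothing  = nothing
  keep Q (just e) = if Q e then just e else nothing

  private
    keep-just : ∀ Q {e} → T (Q e) → keep Q (just e) ≡ just e
    keep-just Q {e} t with Q e
    ... | true = refl

    kept : ∀ Q {m e} → keep Q m ≡ just e → m ≡ just e × T (Q e)
    kept Q {just e'} eq with Q e' in q
    kept Q {just e'} refl | true = refl , Equivalence.from T-≡ q

  swap? : Maybe E → Bool
  swap? = Maybe.maybe special false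

  toA toB : Maybe E → Maybe E → Maybe E
  toA ma mb = keep QA (if swap? mb then mb else ma)
  toB ma mb = keep QB (if swap? mb then ma else mb)

  toA-source : ∀ {ma mb e} → toA ma mb ≡ just e → T (QA e) × (ma ≡ just e ⊎ mb ≡ just e)
  toA-source {ma} {mb} eq with swap? mb
  ... | true  = let src , q = kept QA eq in q , inj₂ src
  ... | false = let src , q = kept QA eq in q , inj₁ src

  toB-source : ∀ {ma mb e} → toB ma mb ≡ just e → T (QB e) × (ma ≡ just e ⊎ mb ≡ just e)
  toB-source {ma} {mb} eq with swap? mb
  ... | true  = let src , q = kept QB eq in q , inj₁ src
  ... | false = let src , q = kept QB eq in q , inj₂ src

  exchange-covers : ∀ {ma mb e} → (∀ {e} → ma ≡ just e → T (Pa e)) → (∀ {e} → mb ≡ just e → T (Pb e)) →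
                    ma ≡ just e ⊎ mb ≡ just e → toA ma mb ≡ just e ⊎ toB ma mb ≡ just e
  exchange-covers {mb = nothing} Pma _ (inj₁ refl) = inj₁ (keep-just QA (a⇒A (Pma refl)))
  exchange-covers {mb = just e'} Pma Pmb src with special e' in sp
  exchange-covers {mb = just e'} Pma Pmb (inj₁ refl) | false = inj₁ (keep-just QA (a⇒A (Pma refl)))
  exchange-covers {mb = just e'} Pma Pmb (inj₂ refl) | false =
    inj₂ (keep-just QB (b⇒B (Pmb refl) (Equivalence.from T-not-≡ sp)))
  exchange-covers {mb = just e'} Pma Pmb (inj₂ refl) | true = inj₁ (keep-just QA (special⇒A (Equivalence.from T-≡ sp)))
  exchange-covers {mb = just e'} {e} Pma Pmb (inj₁ refl) | true with special e in sp′
  ... | true  = inj₁ (subst (λ x → keep QA (just e') ≡ just x)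
                            (special-unique (Equivalence.from T-≡ sp) (Equivalence.from T-≡ sp′))
                            (keep-just QA (special⇒A (Equivalence.from T-≡ sp))))
  ... | false = inj₂ (keep-just QB (a⇒B (Pma refl) (Equivalence.from T-not-≡ sp′)))

module G₁ (r d b : ℕ) where

  Layout : ℕ
  Layout = (2 + r) + suc (d + suc (2 + b))

  layout≡nEdges : Layout ≡ nEdges r d b
  layout≡nEdges = arrangement r d b
    where
      arrangement : ∀ r d b → (2 + r) + suc (d + suc (2 + b)) ≡ 6 + r + d + b
      arrangement = solve-∀
  
  slot : Edge r d b → Fin Layout
  slot (red i)  = i ↑ˡ _
  slot e23      = (2 + r) ↑ʳ zero
  slot (dia k)  = (2 + r) ↑ʳ suc (k ↑ˡ _)
  slot e01      = (2 + r) ↑ʳ suc (d ↑ʳ zero)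
  slot (blue k) = (2 + r) ↑ʳ suc (d ↑ʳ suc k)

  unslot : Fin Layout → Edge r d b
  unslot p with splitAt (2 + r) p
  ... | inj₁ i       = red i
  ... | inj₂ zero    = e23
  ... | inj₂ (suc q) with splitAt d q
  ...   | inj₁ k       = dia k
  ...   | inj₂ zero    = e01
  ...   | inj₂ (suc k) = blue k

  unslot-slot : ∀ e → unslot (slot e) ≡ e
  unslot-slot (red i)  rewrite F.splitAt-↑ˡ (2 + r) i (suc (d + suc (2 + b))) = refl
  unslot-slot e23      rewrite F.splitAt-↑ʳ (2 + r) (suc (d + suc (2 + b))) zero = refl
  unslot-slot (dia k)  rewrite F.splitAt-↑ʳ (2 + r) (suc (d + suc (2 + b))) (suc (k ↑ˡ suc (2 + b)))
                             | F.splitAt-↑ˡ d k (suc (2 + b)) = refl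
  unslot-slot e01      rewrite F.splitAt-↑ʳ (2 + r) (suc (d + suc (2 + b))) (suc (d ↑ʳ zero))
                             | F.splitAt-↑ʳ d (suc (2 + b)) zero = refl
  unslot-slot (blue k) rewrite F.splitAt-↑ʳ (2 + r) (suc (d + suc (2 + b))) (suc (d ↑ʳ suc k))
                             | F.splitAt-↑ʳ d (suc (2 + b)) (suc k) = refl

  slot-unslot : ∀ p → slot (unslot p) ≡ p
  slot-unslot p with splitAt (2 + r) p in eq
  ... | inj₁ i       = F.splitAt⁻¹-↑ˡ eq
  ... | inj₂ zero    = F.splitAt⁻¹-↑ʳ eq
  ... | inj₂ (suc q) with splitAt d q in eq′
  ...   | inj₁ k       = trans (cong (λ x → (2 + r) ↑ʳ suc x) (F.splitAt⁻¹-↑ˡ eq′)) (F.splitAt⁻¹-↑ʳ eq)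
  ...   | inj₂ zero    = trans (cong (λ x → (2 + r) ↑ʳ suc x) (F.splitAt⁻¹-↑ʳ eq′)) (F.splitAt⁻¹-↑ʳ eq)
  ...   | inj₂ (suc k) = trans (cong (λ x → (2 + r) ↑ʳ suc x) (F.splitAt⁻¹-↑ʳ eq′)) (F.splitAt⁻¹-↑ʳ eq)

  position : Edge r d b → Fin (nEdges r d b)
  position = F.cast layout≡nEdges ∘ slot

  edge-at : Fin (nEdges r d b) → Edge r d b
  edge-at = unslot ∘ F.cast (sym layout≡nEdges)

  position-edge-at : ∀ p → position (edge-at p) ≡ p
  position-edge-at p = trans (cong (F.cast layout≡nEdges) (slot-unslot (F.cast (sym layout≡nEdges) p)))
                             (F.cast-involutive layout≡nEdges (sym layout≡nEdges) p)

  edge-at-position : ∀ e → edge-at (position e) ≡ e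
  edge-at-position e = trans (cong unslot (F.cast-involutive (sym layout≡nEdges) layout≡nEdges (slot e))) (unslot-slot e)

  order : Edge r d b ⤖ Fin (nEdges r d b)
  order = ↔⇒⤖ (mk↔ₛ′ position edge-at position-edge-at edge-at-position)

  rank : Edge r d b → ℕ
  rank (red i)  = toℕ i
  rank e23      = 2 + r
  rank (dia k)  = 2 + r + suc (toℕ k)
  rank e01      = 2 + r + suc d
  rank (blue k) = 2 + r + suc (d + suc (toℕ k))

  toℕ-position : ∀ e → toℕ (position e) ≡ rank e
  toℕ-position e = trans (F.toℕ-cast layout≡nEdges (slot e)) (toℕ-slot e)
    where
      toℕ-slot : ∀ e → toℕ (slot e) ≡ rank e
      toℕ-slot (red i)  = F.toℕ-↑ˡ i _
      toℕ-slot e23      = trans (F.toℕ-↑ʳ (2 + r) zero) (ℕ.+-identityʳ _)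
      toℕ-slot (dia k)  = trans (F.toℕ-↑ʳ (2 + r) _) (cong (λ x → 2 + r + suc x) (F.toℕ-↑ˡ k _))
      toℕ-slot e01      = trans (F.toℕ-↑ʳ (2 + r) _)
                                (cong (λ x → 2 + r + suc x) (trans (F.toℕ-↑ʳ d zero) (ℕ.+-identityʳ d)))
      toℕ-slot (blue k) = trans (F.toℕ-↑ʳ (2 + r) _) (cong (λ x → 2 + r + suc x) (F.toℕ-↑ʳ d (suc k)))

  open Bicircular (ends {r} {d} {b}) using (Endpoint; endpoint?)

  incident : Fin 4 → Edge r d b → Bool
  incident v e = isYes (endpoint? F._≟_ v e)

  isRed₀ isLastBlue isE01 isE23 : Edge r d b → Bool
  isRed₀ (red 0F)     = true
  isRed₀ _            = false
  isLastBlue (blue k) = isLast k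
  isLastBlue _        = false
  isE01 e01           = true
  isE01 _             = false
  isE23 e23           = true
  isE23 _             = false

  penultimate last : Fin (2 + b)
  penultimate = inject₁ (fromℕ b)
  last        = fromℕ (suc b)

  lo-edge hi-edge : Fin 4 → Edge r d b
  lo-edge 0F = red 0F
  lo-edge 1F = red 1F
  lo-edge 2F = e23
  lo-edge 3F = e01
  hi-edge 0F = e23
  hi-edge 1F = e01
  hi-edge 2F = blue penultimate
  hi-edge 3F = blue last

  lo hi : Fin 4 → Fin (nEdges r d b)
  lo = position ∘ lo-edge
  hi = position ∘ hi-edge

  open Intervals position lo hi public

  fits : Fin 4 → Edge r d b → Bool
  fits 0F e = incident x2 e
  fits 1F e = incident x0 e ∧ not (isRed₀ e) ∨ isE23 e
  fits 2F e = incident x3 e ∧ not (isLastBlue e) ∨ isE01 e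
  fits 3F e = incident x1 e

  private
    shift : ∀ {x y} → x ℕ.≤ y → 2 + r + x ℕ.≤ 2 + r + y
    shift = ℕ.+-monoʳ-≤ (2 + r)

    unshift : ∀ {x y} → 2 + r + x ℕ.≤ 2 + r + y → x ℕ.≤ y
    unshift = ℕ.+-cancelˡ-≤ (2 + r) _ _

    toℕ-penultimate : toℕ penultimate ≡ b
    toℕ-penultimate = trans (F.toℕ-inject₁ (fromℕ b)) (F.toℕ-fromℕ b)

    blue≤last : ∀ (k : Fin (2 + b)) → toℕ k ℕ.≤ toℕ last
    blue≤last k = subst (toℕ k ℕ.≤_) (sym (F.toℕ-fromℕ (suc b))) (ℕ.≤-pred (F.toℕ<n k))

    InRange : Fin 4 → Edge r d b → Set
    InRange j e = rank (lo-edge j) ℕ.≤ rank e × rank e ℕ.≤ rank (hi-edge j)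

    fits⇒in-range : ∀ j e → T (fits j e) → InRange j e
    fits⇒in-range 0F (red i)       _ = ℕ.z≤n , ℕ.<⇒≤ (F.toℕ<n i)
    fits⇒in-range 0F e23           _ = ℕ.z≤n , ℕ.≤-refl
    fits⇒in-range 1F (red (suc i)) _ = ℕ.s≤s ℕ.z≤n , ℕ.≤-trans (ℕ.<⇒≤ (F.toℕ<n (suc i))) (ℕ.m≤m+n _ _)
    fits⇒in-range 1F e23           _ = ℕ.s≤s ℕ.z≤n , ℕ.m≤m+n _ _
    fits⇒in-range 1F (dia k)       _ = ℕ.s≤s ℕ.z≤n , shift (ℕ.s≤s (ℕ.<⇒≤ (F.toℕ<n k)))
    fits⇒in-range 1F e01           _ = ℕ.s≤s ℕ.z≤n , ℕ.≤-refl
    fits⇒in-range 2F e23           _ = ℕ.≤-refl , ℕ.m≤m+n _ _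
    fits⇒in-range 2F (dia k)       _ = ℕ.m≤m+n _ _ , shift (ℕ.s≤s (ℕ.≤-trans (ℕ.<⇒≤ (F.toℕ<n k)) (ℕ.m≤m+n d _)))
    fits⇒in-range 2F e01           _ = ℕ.m≤m+n _ _ , shift (ℕ.s≤s (ℕ.m≤m+n d _))
    fits⇒in-range 2F (blue k)      t with isLast k in eq
    ... | false = ℕ.m≤m+n _ _ , shift (ℕ.s≤s (ℕ.+-monoʳ-≤ d (ℕ.s≤s k≤)))
      where k≤ = subst (toℕ k ℕ.≤_) (sym toℕ-penultimate) (ℕ.≤-pred (¬isLast⇒toℕ< k eq))
    fits⇒in-range 3F e01           _ = ℕ.≤-refl , shift (ℕ.s≤s (ℕ.m≤m+n d _))
    fits⇒in-range 3F (blue k)      _ = shift (ℕ.s≤s (ℕ.m≤m+n d _)) , shift (ℕ.s≤s (ℕ.+-monoʳ-≤ d (ℕ.s≤s (blue≤last k))))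

    in-range⇒fits : ∀ j e → InRange j e → T (fits j e)
    in-range⇒fits 0F (red i)       _        = _
    in-range⇒fits 0F e23           _        = _
    in-range⇒fits 0F (dia k)       (_ , le) = ℕ.m+1+n≰m (2 + r) le
    in-range⇒fits 0F e01           (_ , le) = ℕ.m+1+n≰m (2 + r) le
    in-range⇒fits 0F (blue k)      (_ , le) = ℕ.m+1+n≰m (2 + r) le
    in-range⇒fits 1F (red (suc i)) _        = _
    in-range⇒fits 1F e23           _        = _
    in-range⇒fits 1F (dia k)       _        = _
    in-range⇒fits 1F e01           _        = _
    in-range⇒fits 1F (blue k)      (_ , le) = ℕ.m+1+n≰m d (ℕ.≤-pred (unshift le))
    in-range⇒fits 2F (red i)       (le , _) = ℕ.<⇒≱ (F.toℕ<n i) le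
    in-range⇒fits 2F e23           _        = _
    in-range⇒fits 2F (dia k)       _        = _
    in-range⇒fits 2F e01           _        = _
    in-range⇒fits 2F (blue k)      (_ , le) with isLast k in eq
    ... | false = _
    ... | true  = ℕ.<⇒≱ (ℕ.n<1+n b) (subst₂ ℕ._≤_ (trans (cong toℕ (isLast⇒≡fromℕ k eq)) (F.toℕ-fromℕ _)) toℕ-penultimate
                                        (ℕ.≤-pred (ℕ.+-cancelˡ-≤ d _ _ (ℕ.≤-pred (unshift le)))))
    in-range⇒fits 3F (red i)       (le , _) = ℕ.<⇒≱ (ℕ.<-≤-trans (F.toℕ<n i) (ℕ.m≤m+n _ _)) le
    in-range⇒fits 3F e23           (le , _) = ℕ.m+1+n≰m (2 + r) le
    in-range⇒fits 3F (dia k)       (le , _) = ℕ.<⇒≱ (F.toℕ<n k) (ℕ.≤-pred (unshift le))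
    in-range⇒fits 3F e01           _        = _
    in-range⇒fits 3F (blue k)      _        = _

  fits⇒in : ∀ {j e} → T (fits j e) → InInterval j (position e)
  fits⇒in {j} {e} t with fits⇒in-range j e t
  ... | l , h = subst₂ ℕ._≤_ (sym (toℕ-position (lo-edge j))) (sym (toℕ-position e)) l ,
                subst₂ ℕ._≤_ (sym (toℕ-position e)) (sym (toℕ-position (hi-edge j))) h

  in⇒fits : ∀ {j e} → InInterval j (position e) → T (fits j e)
  in⇒fits {j} {e} (l , h) = in-range⇒fits j e
    (subst₂ ℕ._≤_ (toℕ-position (lo-edge j)) (toℕ-position e) l ,
     subst₂ ℕ._≤_ (toℕ-position e) (toℕ-position (hi-edge j)) h)

  private
    separator : Fin 4 → Fin 4 → Edge r d b
    separator 0F _  = red 0F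
    separator 1F 0F = e01
    separator 1F _  = red 1F
    separator 2F 3F = e23
    separator 2F _  = blue penultimate
    separator 3F _  = blue last

    penultimate-fits : T (fits 2F (blue penultimate))
    penultimate-fits = subst (λ x → T (not x ∨ false)) (sym (isLast-inject₁ (fromℕ b))) _

    last-unfit : ¬ T (fits 2F (blue last))
    last-unfit = subst (λ x → ¬ T (not x ∨ false)) (sym (isLast-fromℕ (suc b))) λ ()

    separates : ∀ i j → i ≢ j → T (fits i (separator i j)) × ¬ T (fits j (separator i j))
    separates 0F 1F _ = _ , λ ()
    separates 0F 2F _ = _ , λ ()
    separates 0F 3F _ = _ , λ ()
    separates 1F 0F _ = _ , λ ()
    separates 1F 2F _ = _ , λ ()
    separates 1F 3F _ = _ , λ ()
    separates 2F 0F _ = penultimate-fits , λ ()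
    separates 2F 1F _ = penultimate-fits , λ ()
    separates 2F 3F _ = _ , λ ()
    separates 3F 0F _ = _ , λ ()
    separates 3F 1F _ = _ , λ ()
    separates 3F 2F _ = _ , last-unfit
    separates 0F 0F i≢j = ⊥-elim (i≢j refl)
    separates 1F 1F i≢j = ⊥-elim (i≢j refl)
    separates 2F 2F i≢j = ⊥-elim (i≢j refl)
    separates 3F 3F i≢j = ⊥-elim (i≢j refl)

  valid-presentation : ValidPresentation
  valid-presentation = lo≤hi , incomparable
    where
      lo-fits : ∀ i → T (fits i (lo-edge i))
      lo-fits 0F = _
      lo-fits 1F = _
      lo-fits 2F = _
      lo-fits 3F = _

      lo≤hi : ∀ i → lo i F.≤ hi i
      lo≤hi i = proj₂ (fits⇒in {i} (lo-fits i))

      incomparable : ∀ i j → i ≢ j → ¬ (∀ p → InInterval i p → InInterval j p)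
      incomparable i j i≢j i⊆j with separates i j i≢j
      ... | inside , outside = outside (in⇒fits {j} (i⊆j _ (fits⇒in {i} inside)))

  position-injective : ∀ {e e'} → position e ≡ position e' → e ≡ e'
  position-injective = Bijection.injective order

  minimum-red : ∀ e → position e ≡ zero → IsRed e
  minimum-red e eq = 0F , position-injective (trans eq (F.toℕ-injective (sym (toℕ-position (red 0F)))))

  maximum-blue : ∀ e → position e ≡ fromℕ (5 + r + d + b) → IsBlue e
  maximum-blue e eq = last , position-injective (trans eq (F.toℕ-injective top))
    where
      top : toℕ (fromℕ (5 + r + d + b)) ≡ toℕ (position (blue last))
      top = begin
        toℕ (fromℕ (5 + r + d + b))                   ≡⟨ F.toℕ-fromℕ _ ⟩
        5 + r + d + b                                 ≡⟨ arrangement r d b ⟩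
        2 + r + suc (d + suc (suc b))                 ≡⟨ cong (λ x → 2 + r + suc (d + suc x)) (F.toℕ-fromℕ (suc b)) ⟨
        rank (blue last)                              ≡⟨ toℕ-position (blue last) ⟨
        toℕ (position (blue last))                    ∎
        where
          open ≡-Reasoning
          arrangement : ∀ r d b → 5 + r + d + b ≡ 2 + r + suc (d + suc (suc b))
          arrangement = solve-∀

  StarCover IntervalCover : EdgeSet (Edge r d b) → Set
  StarCover I     = Cover I Endpoint
  IntervalCover I = Cover I (λ j e → InInterval j (position e))

  private
    ∧∨-intro : ∀ {x y z} → T x → T y → T (x ∧ y ∨ z)
    ∧∨-intro {true} {true} _ _ = _

    ∧∨-elim : ∀ {x y z} → T (x ∧ y ∨ z) → T (not z) → T x
    ∧∨-elim {true}              _  _  = _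
    ∧∨-elim {false} {z = false} ()
    ∧∨-elim {false} {z = true}  _  ()

    isRed₀-unique : ∀ {e e'} → T (isRed₀ e) → T (isRed₀ e') → e ≡ e'
    isRed₀-unique {red 0F} {red 0F} _ _ = refl

    isLastBlue-unique : ∀ {e e'} → T (isLastBlue e) → T (isLastBlue e') → e ≡ e'
    isLastBlue-unique {blue k} {blue k'} t t' = cong blue (trans (last≡ k t) (sym (last≡ k' t')))
      where last≡ : ∀ k → T (isLast k) → k ≡ last
            last≡ k t = isLast⇒≡fromℕ k (Equivalence.to T-≡ t)

    isE23-unique : ∀ {e e'} → T (isE23 e) → T (isE23 e') → e ≡ e'
    isE23-unique {e23} {e23} _ _ = refl

    isE01-unique : ∀ {e e'} → T (isE01 e) → T (isE01 e') → e ≡ e'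
    isE01-unique {e01} {e01} _ _ = refl

    x2-fits₁ : ∀ {e} → T (incident x2 e) → T (not (isRed₀ e)) → T (fits 1F e)
    x2-fits₁ {red (suc _)} _ _ = _
    x2-fits₁ {e23}         _ _ = _

    x1-fits₂ : ∀ {e} → T (incident x1 e) → T (not (isLastBlue e)) → T (fits 2F e)
    x1-fits₂ {blue k} _ t = Equivalence.from T-∨ (inj₁ t)
    x1-fits₂ {e01}    _ _ = _

    x0-fits₁ : ∀ {e} → T (incident x0 e) → T (not (isRed₀ e)) → T (fits 1F e)
    x0-fits₁ {e} = ∧∨-intro {incident x0 e}

    x3-fits₂ : ∀ {e} → T (incident x3 e) → T (not (isLastBlue e)) → T (fits 2F e)
    x3-fits₂ {e} = ∧∨-intro {incident x3 e}

    red₀-fits₀ : ∀ {e} → T (isRed₀ e) → T (fits 0F e)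
    red₀-fits₀ {red 0F} _ = _

    lastBlue-fits₃ : ∀ {e} → T (isLastBlue e) → T (fits 3F e)
    lastBlue-fits₃ {blue _} _ = _

    fits₀-x0 : ∀ {e} → T (fits 0F e) → T (not (isE23 e)) → T (incident x0 e)
    fits₀-x0 {red _} _ _ = _

    fits₃-x3 : ∀ {e} → T (fits 3F e) → T (not (isE01 e)) → T (incident x3 e)
    fits₃-x3 {blue _} _ _ = _

    fits₁-x0 : ∀ {e} → T (fits 1F e) → T (not (isE23 e)) → T (incident x0 e)
    fits₁-x0 {e} = ∧∨-elim {incident x0 e}

    fits₂-x3 : ∀ {e} → T (fits 2F e) → T (not (isE01 e)) → T (incident x3 e)
    fits₂-x3 {e} = ∧∨-elim {incident x3 e}

    e23-x2 : ∀ {e} → T (isE23 e) → T (incident x2 e)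
    e23-x2 {e23} _ = _

    e01-x1 : ∀ {e} → T (isE01 e) → T (incident x1 e)
    e01-x1 {e01} _ = _

  star⇒interval : ∀ {I} → StarCover I → IntervalCover I
  star⇒interval {I} cov = record
    { pick = pick′
    ; pick-in = λ {j} eq → pick-in (proj₂ (proj₂ (source j eq)))
    ; pick-allowed = λ {j} {e} eq → fits⇒in {j} {e} (proj₁ (source j eq))
    ; covers = covers′ }
    where
      open Cover cov

      module Low  = Exchange isRed₀ isRed₀-unique (incident x2) (incident x0) (fits 0F) (fits 1F)
                             (λ t → t) (λ {e} → x2-fits₁ {e}) (λ {e} → x0-fits₁ {e}) (λ {e} → red₀-fits₀ {e})
      module High = Exchange isLastBlue isLastBlue-unique (incident x1) (incident x3) (fits 3F) (fits 2F)
                             (λ t → t) (λ {e} → x1-fits₂ {e}) (λ {e} → x3-fits₂ {e}) (λ {e} → lastBlue-fits₃ {e})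

      pick′ : Fin 4 → Maybe (Edge r d b)
      pick′ 0F = Low.toA  (pick x2) (pick x0)
      pick′ 1F = Low.toB  (pick x2) (pick x0)
      pick′ 2F = High.toB (pick x1) (pick x3)
      pick′ 3F = High.toA (pick x1) (pick x3)

      source : ∀ j {e} → pick′ j ≡ just e → T (fits j e) × ∃ λ v → pick v ≡ just e
      either : ∀ u w {e} → pick u ≡ just e ⊎ pick w ≡ just e → ∃ λ v → pick v ≡ just e
      either u w = [ (u ,_) , (w ,_) ]

      source 0F eq = map₂ (either x2 x0) (Low.toA-source eq)
      source 1F eq = map₂ (either x2 x0) (Low.toB-source eq)
      source 2F eq = map₂ (either x1 x3) (High.toB-source eq)
      source 3F eq = map₂ (either x1 x3) (High.toA-source eq)

      incident-at : ∀ v {e} → pick v ≡ just e → T (incident v e)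
      incident-at v eq = fromWitness (pick-allowed eq)

      covers′ : ∀ {e} → I e ≡ true → ∃ λ j → pick′ j ≡ just e
      covers′ p with covers p
      ... | 0F , eq = [ (0F ,_) , (1F ,_) ] (Low.exchange-covers  (incident-at x2) (incident-at x0) (inj₂ eq))
      ... | 2F , eq = [ (0F ,_) , (1F ,_) ] (Low.exchange-covers  (incident-at x2) (incident-at x0) (inj₁ eq))
      ... | 1F , eq = [ (3F ,_) , (2F ,_) ] (High.exchange-covers (incident-at x1) (incident-at x3) (inj₁ eq))
      ... | 3F , eq = [ (3F ,_) , (2F ,_) ] (High.exchange-covers (incident-at x1) (incident-at x3) (inj₂ eq))

  interval⇒star : ∀ {I} → IntervalCover I → StarCover I
  interval⇒star {I} cov = record
    { pick = pick′
    ; pick-in = λ {v} eq → pick-in (proj₂ (proj₂ (source v eq)))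
    ; pick-allowed = λ {v} eq → toWitness (proj₁ (source v eq))
    ; covers = covers′ }
    where
      open Cover cov

      module Low  = Exchange isE23 isE23-unique (fits 0F) (fits 1F) (incident x2) (incident x0)
                             (λ t → t) (λ {e} → fits₀-x0 {e}) (λ {e} → fits₁-x0 {e}) (λ {e} → e23-x2 {e})
      module High = Exchange isE01 isE01-unique (fits 3F) (fits 2F) (incident x1) (incident x3)
                             (λ t → t) (λ {e} → fits₃-x3 {e}) (λ {e} → fits₂-x3 {e}) (λ {e} → e01-x1 {e})

      pick′ : Fin 4 → Maybe (Edge r d b)
      pick′ 0F = Low.toB  (pick 0F) (pick 1F)
      pick′ 1F = High.toA (pick 3F) (pick 2F)
      pick′ 2F = Low.toA  (pick 0F) (pick 1F)
      pick′ 3F = High.toB (pick 3F) (pick 2F)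

      either : ∀ i j {e} → pick i ≡ just e ⊎ pick j ≡ just e → ∃ λ k → pick k ≡ just e
      either i j = [ (i ,_) , (j ,_) ]

      source : ∀ v {e} → pick′ v ≡ just e → T (incident v e) × ∃ λ j → pick j ≡ just e
      source 0F eq = map₂ (either 0F 1F) (Low.toB-source eq)
      source 1F eq = map₂ (either 3F 2F) (High.toA-source eq)
      source 2F eq = map₂ (either 0F 1F) (Low.toA-source eq)
      source 3F eq = map₂ (either 3F 2F) (High.toB-source eq)

      fits-at : ∀ j {e} → pick j ≡ just e → T (fits j e)
      fits-at j eq = in⇒fits {j} (pick-allowed eq)

      covers′ : ∀ {e} → I e ≡ true → ∃ λ v → pick′ v ≡ just e
      covers′ p with covers p
      ... | 0F , eq = [ (2F ,_) , (0F ,_) ] (Low.exchange-covers  (fits-at 0F) (fits-at 1F) (inj₁ eq))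
      ... | 1F , eq = [ (2F ,_) , (0F ,_) ] (Low.exchange-covers  (fits-at 0F) (fits-at 1F) (inj₂ eq))
      ... | 2F , eq = [ (1F ,_) , (3F ,_) ] (High.exchange-covers (fits-at 3F) (fits-at 2F) (inj₂ eq))
      ... | 3F , eq = [ (1F ,_) , (3F ,_) ] (High.exchange-covers (fits-at 3F) (fits-at 2F) (inj₁ eq))

module RoleGraph where

  -- red k stands for the k-th red edge of a subset of G₁(r,d,b), and likewise for the other colours.
  Role : Set
  Role = Edge 1 3 1

  open Graph (ends {1} {3} {1}) using (BicircularIndep; Reach; here; step)
  open Bicircular (ends {1} {3} {1}) using (Endpoint; module DecidableCycles; two-cycles⇒dependent)
  private
    module O = G₁ 1 3 1

  _≟ʳ_ : DecidableEquality Role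
  ρ ≟ʳ ρ' = Dec.map′ O.position-injective (cong O.position) (O.position ρ F.≟ O.position ρ')

  allRoles : List Role
  allRoles = List.map O.unslot (List.allFin O.Layout)

  ∈-allRoles : ∀ ρ → ρ ∈ allRoles
  ∈-allRoles ρ = subst (_∈ allRoles) (O.unslot-slot ρ) (∈-map⁺ O.unslot (∈-allFin (O.slot ρ)))

  record Profile : Set where
    constructor profile
    field
      reds dias blues : Fin 4
      has-e01 has-e23 : Bool

  open Profile

  roles : Profile → EdgeSet Role
  roles p (red k)  = toℕ k ℕ.<ᵇ toℕ (reds p)
  roles p (dia k)  = toℕ k ℕ.<ᵇ toℕ (dias p)
  roles p (blue k) = toℕ k ℕ.<ᵇ toℕ (blues p)
  roles p e01      = has-e01 p
  roles p e23      = has-e23 p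

  _≼_ : Profile → Profile → Set
  q ≼ p = toℕ (reds q) ℕ.≤ toℕ (reds p) × toℕ (dias q) ℕ.≤ toℕ (dias p) × toℕ (blues q) ℕ.≤ toℕ (blues p) ×
          (T (has-e01 q) → T (has-e01 p)) × (T (has-e23 q) → T (has-e23 p))

  _≼?_ : ∀ q p → Dec (q ≼ p)
  q ≼? p = toℕ (reds q) ℕ.≤? toℕ (reds p) ×-dec toℕ (dias q) ℕ.≤? toℕ (dias p) ×-dec
           toℕ (blues q) ℕ.≤? toℕ (blues p) ×-dec (T? (has-e01 q) →-dec T? (has-e01 p)) ×-dec
           (T? (has-e23 q) →-dec T? (has-e23 p))

  ≼⇒⊆ : ∀ {q p} → q ≼ p → ∀ {ρ} → roles q ρ ≡ true → roles p ρ ≡ true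
  ≼⇒⊆ {q} {p} (r≤ , d≤ , b≤ , a⇒ , c⇒) {ρ} = Equivalence.to T-≡ ∘ lift ρ ∘ Equivalence.from T-≡
    where
      below : ∀ {k m n} → m ℕ.≤ n → T (k ℕ.<ᵇ m) → T (k ℕ.<ᵇ n)
      below {k} {m} m≤n t = ℕ.<⇒<ᵇ (ℕ.<-≤-trans (ℕ.<ᵇ⇒< k m t) m≤n)
      lift : ∀ ρ → T (roles q ρ) → T (roles p ρ)
      lift (red k)  = below r≤
      lift (dia k)  = below d≤
      lift (blue k) = below b≤
      lift e01      = a⇒
      lift e23      = c⇒

  Placement : Set
  Placement = Fin 4 → Maybe Role

  module Search (J : EdgeSet Role) where

    Sound : Placement → Set
    Sound σ = ∀ {v ρ} → σ v ≡ just ρ → J ρ ≡ true × Endpoint v ρ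

    _⊑_ : Placement → Placement → Set
    σ ⊑ τ = ∀ {v ρ} → σ v ≡ just ρ → τ v ≡ just ρ

    update : Placement → Fin 4 → Role → Placement
    update σ v ρ w = if does (w F.≟ v) then just ρ else σ w

    place : Placement → Fin 4 → Role → Maybe Placement
    place σ v ρ with σ v
    ... | just _  = nothing
    ... | nothing = just (update σ v ρ)

    orient : List Role → Placement → Maybe Placement
    orient []       σ = just σ
    orient (ρ ∷ ρs) σ = if J ρ then at (proj₁ (ends ρ)) <∣> at (proj₂ (ends ρ)) else orient ρs σ
      where at = λ v → place σ v ρ >>= orient ρs

    private
      <∣>-just : ∀ {A : Set} (m n : Maybe A) {x} → (m <∣> n) ≡ just x → m ≡ just x ⊎ n ≡ just x
      <∣>-just (just _) _ eq = inj₁ eq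
      <∣>-just nothing  _ eq = inj₂ eq

      >>=-just : ∀ {A B : Set} (m : Maybe A) {f : A → Maybe B} {x} → (m >>= f) ≡ just x → ∃ λ y → m ≡ just y × f y ≡ just x
      >>=-just (just y) eq = y , refl , eq

      place-just : ∀ σ v ρ {σ'} → place σ v ρ ≡ just σ' →
                   σ' v ≡ just ρ × σ ⊑ σ' × (∀ {w ρ'} → σ' w ≡ just ρ' → σ w ≡ just ρ' ⊎ (w ≡ v × ρ' ≡ ρ))
      place-just σ v ρ eq with σ v in σv
      place-just σ v ρ refl | nothing = new , old , back
        where
          new : update σ v ρ v ≡ just ρ
          new with v F.≟ v
          ... | yes _  = refl
          ... | no v≢v = ⊥-elim (v≢v refl)
          old : σ ⊑ update σ v ρ
          old {w} σw with w F.≟ v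
          ... | yes refl = case trans (sym σv) σw of λ ()
          ... | no _     = σw
          back : ∀ {w ρ'} → update σ v ρ w ≡ just ρ' → σ w ≡ just ρ' ⊎ (w ≡ v × ρ' ≡ ρ)
          back {w} eq′ with w F.≟ v
          back refl | yes w≡v = inj₂ (w≡v , refl)
          back eq′  | no _    = inj₁ eq′

      place-sound : ∀ {σ v ρ σ′} → Sound σ → J ρ ≡ true → Endpoint v ρ → place σ v ρ ≡ just σ′ → Sound σ′
      place-sound {σ} {v} {ρ} sound Jρ end placed eq with proj₂ (proj₂ (place-just σ v ρ placed)) eq
      ... | inj₁ old            = sound old
      ... | inj₂ (refl , refl) = Jρ , end

    orient-just : ∀ ρs σ {τ} → Sound σ → orient ρs σ ≡ just τ →
                  Sound τ × σ ⊑ τ × (∀ {ρ} → ρ ∈ ρs → J ρ ≡ true → ∃ λ v → τ v ≡ just ρ)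
    orient-just []       σ sound refl = sound , (λ x → x) , λ ()
    orient-just (ρ ∷ ρs) σ {τ} sound eq with J ρ in Jρ
    ... | false with orient-just ρs σ sound eq
    ...   | sound′ , σ⊑τ , covered =
            sound′ , σ⊑τ , λ { (here refl) Jρ′ → case trans (sym Jρ) Jρ′ of λ () ; (there m) → covered m }
    orient-just (ρ ∷ ρs) σ {τ} sound eq | true =
      [ via (inj₁ refl) , via (inj₂ refl) ] (<∣>-just (place σ (proj₁ (ends ρ)) ρ >>= orient ρs) _ eq)
      where
        via : ∀ {v} → Endpoint v ρ → (place σ v ρ >>= orient ρs) ≡ just τ →
              Sound τ × σ ⊑ τ × (∀ {ρ′} → ρ′ ∈ ρ ∷ ρs → J ρ′ ≡ true → ∃ λ w → τ w ≡ just ρ′)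
        via {v} end eq′ with >>=-just (place σ v ρ) eq′
        ... | σ′ , placed , rest with place-just σ v ρ placed
                                   | orient-just ρs σ′ (place-sound sound Jρ end placed) rest
        ...   | at-v , σ⊑σ′ , _ | soundτ , σ′⊑τ , covered =
                soundτ , σ′⊑τ ∘ σ⊑σ′ , λ { (here refl) _ → v , σ′⊑τ at-v ; (there m) → covered m }

    search : Maybe Placement
    search = orient allRoles (λ _ → nothing)

    search-cover : ∀ {σ} → search ≡ just σ → Cover J Endpoint
    search-cover {σ} eq with orient-just allRoles _ (λ ()) eq
    ... | sound , _ , covered = record
      { pick = σ
      ; pick-in = proj₁ ∘ sound
      ; pick-allowed = proj₂ ∘ sound
      ; covers = λ {ρ} → covered (∈-allRoles ρ) }

  module _ (J : EdgeSet Role) where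

    open DecidableCycles F._≟_ _≟ʳ_ J using (cycle; isCycle?)

    bicycle : ∀ {L L′} (vC : Vec (Fin 4) (2 + L)) (eC : Vec Role (suc L))
                       (vD : Vec (Fin 4) (2 + L′)) (eD : Vec Role (suc L′)) →
              {validC : True (isCycle? (Vec.lookup vC) (Vec.lookup eC))} →
              {validD : True (isCycle? (Vec.lookup vD) (Vec.lookup eD))} →
              Reach J (Vec.lookup vC 0F) (Vec.lookup vD 0F) → (i : Fin (suc L)) →
              {outside : True (¬? (F.any? λ j → Vec.lookup eD j ≟ʳ Vec.lookup eC i))} →
              ¬ BicircularIndep J
    bicycle vC eC vD eD {validC} {validD} r i {outside} =
      two-cycles⇒dependent (cycle (Vec.lookup vC) (Vec.lookup eC) {validC}) (cycle (Vec.lookup vD) (Vec.lookup eD) {validD})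
                           (0F , refl) (0F , refl) r (i , refl) (toWitness outside)

  -- The bicycles of G₁(1,3,1), up to relabelling edges of one colour.
  shapes : List Profile
  shapes =
      profile 3F 0F 0F false false
    ∷ profile 0F 3F 0F false false
    ∷ profile 0F 0F 3F false false
    ∷ profile 2F 2F 0F false false
    ∷ profile 2F 1F 0F false true
    ∷ profile 1F 2F 0F false true
    ∷ profile 0F 2F 2F false false
    ∷ profile 0F 1F 2F true  false
    ∷ profile 0F 2F 1F true  false
    ∷ profile 2F 0F 2F true  false
    ∷ profile 2F 0F 2F false true
    ∷ profile 2F 0F 1F true  true
    ∷ profile 1F 0F 2F true  true
    ∷ profile 2F 1F 2F false false
    ∷ profile 2F 1F 1F true  false
    ∷ profile 1F 1F 2F false true
    ∷ profile 1F 1F 1F true  true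
    ∷ []

  shapes-dependent : All (λ q → ¬ BicircularIndep (roles q)) shapes
  shapes-dependent =
      bicycle _ (x0 ∷ x2 ∷ x0 ∷ []) (red 0F ∷ red 1F ∷ []) (x0 ∷ x2 ∷ x0 ∷ []) (red 0F ∷ red 2F ∷ []) here 1F
    ∷ bicycle _ (x0 ∷ x3 ∷ x0 ∷ []) (dia 0F ∷ dia 1F ∷ []) (x0 ∷ x3 ∷ x0 ∷ []) (dia 0F ∷ dia 2F ∷ []) here 1F
    ∷ bicycle _ (x1 ∷ x3 ∷ x1 ∷ []) (blue 0F ∷ blue 1F ∷ []) (x1 ∷ x3 ∷ x1 ∷ []) (blue 0F ∷ blue 2F ∷ []) here 1F
    ∷ bicycle _ (x0 ∷ x2 ∷ x0 ∷ []) (red 0F ∷ red 1F ∷ []) (x0 ∷ x3 ∷ x0 ∷ []) (dia 0F ∷ dia 1F ∷ []) here 0F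
    ∷ bicycle _ (x0 ∷ x2 ∷ x0 ∷ []) (red 0F ∷ red 1F ∷ []) (x0 ∷ x2 ∷ x3 ∷ x0 ∷ []) (red 0F ∷ e23 ∷ dia 0F ∷ []) here 1F
    ∷ bicycle _ (x0 ∷ x3 ∷ x0 ∷ []) (dia 0F ∷ dia 1F ∷ []) (x0 ∷ x2 ∷ x3 ∷ x0 ∷ []) (red 0F ∷ e23 ∷ dia 0F ∷ []) here 1F
    ∷ bicycle _ (x3 ∷ x0 ∷ x3 ∷ []) (dia 0F ∷ dia 1F ∷ []) (x3 ∷ x1 ∷ x3 ∷ []) (blue 0F ∷ blue 1F ∷ []) here 0F
    ∷ bicycle _ (x1 ∷ x3 ∷ x1 ∷ []) (blue 0F ∷ blue 1F ∷ []) (x1 ∷ x3 ∷ x0 ∷ x1 ∷ []) (blue 0F ∷ dia 0F ∷ e01 ∷ []) here 1F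
    ∷ bicycle _ (x0 ∷ x3 ∷ x0 ∷ []) (dia 0F ∷ dia 1F ∷ []) (x0 ∷ x3 ∷ x1 ∷ x0 ∷ []) (dia 0F ∷ blue 0F ∷ e01 ∷ []) here 1F
    ∷ bicycle _ (x0 ∷ x2 ∷ x0 ∷ []) (red 0F ∷ red 1F ∷ []) (x1 ∷ x3 ∷ x1 ∷ []) (blue 0F ∷ blue 1F ∷ [])
              (step e01 refl (inj₁ refl) here) 0F
    ∷ bicycle _ (x2 ∷ x0 ∷ x2 ∷ []) (red 0F ∷ red 1F ∷ []) (x3 ∷ x1 ∷ x3 ∷ []) (blue 0F ∷ blue 1F ∷ [])
              (step e23 refl (inj₁ refl) here) 0F
    ∷ bicycle _ (x0 ∷ x2 ∷ x0 ∷ []) (red 0F ∷ red 1F ∷ []) (x0 ∷ x2 ∷ x3 ∷ x1 ∷ x0 ∷ []) (red 0F ∷ e23 ∷ blue 0F ∷ e01 ∷ [])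
              here 1F
    ∷ bicycle _ (x1 ∷ x3 ∷ x1 ∷ []) (blue 0F ∷ blue 1F ∷ []) (x1 ∷ x3 ∷ x2 ∷ x0 ∷ x1 ∷ []) (blue 0F ∷ e23 ∷ red 0F ∷ e01 ∷ [])
              here 1F
    ∷ bicycle _ (x0 ∷ x2 ∷ x0 ∷ []) (red 0F ∷ red 1F ∷ []) (x3 ∷ x1 ∷ x3 ∷ []) (blue 0F ∷ blue 1F ∷ [])
              (step (dia 0F) refl (inj₁ refl) here) 0F
    ∷ bicycle _ (x0 ∷ x2 ∷ x0 ∷ []) (red 0F ∷ red 1F ∷ []) (x0 ∷ x3 ∷ x1 ∷ x0 ∷ []) (dia 0F ∷ blue 0F ∷ e01 ∷ []) here 0F
    ∷ bicycle _ (x3 ∷ x1 ∷ x3 ∷ []) (blue 0F ∷ blue 1F ∷ []) (x3 ∷ x2 ∷ x0 ∷ x3 ∷ []) (e23 ∷ red 0F ∷ dia 0F ∷ []) here 0F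
    ∷ bicycle _ (x0 ∷ x2 ∷ x3 ∷ x0 ∷ []) (red 0F ∷ e23 ∷ dia 0F ∷ []) (x0 ∷ x3 ∷ x1 ∷ x0 ∷ []) (dia 0F ∷ blue 0F ∷ e01 ∷ [])
              here 0F
    ∷ []

  Overfull : Profile → Set
  Overfull p = Any (_≼ p) shapes

  private
    ∀ᶠ : ∀ {n} → (Fin n → Bool) → Bool
    ∀ᶠ {zero}  f = true
    ∀ᶠ {suc n} f = f zero ∧ ∀ᶠ (f ∘ suc)

    ∀ᶠ-sound : ∀ {n} (f : Fin n → Bool) → T (∀ᶠ f) → ∀ k → T (f k)
    ∀ᶠ-sound {suc n} f t zero    = proj₁ (Equivalence.to T-∧ t)
    ∀ᶠ-sound {suc n} f t (suc k) = ∀ᶠ-sound (f ∘ suc) (proj₂ (Equivalence.to T-∧ t)) k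

    ∀ᵇ : (Bool → Bool) → Bool
    ∀ᵇ f = f false ∧ f true

    ∀ᵇ-sound : ∀ f → T (∀ᵇ f) → ∀ x → T (f x)
    ∀ᵇ-sound f t false = proj₁ (Equivalence.to T-∧ t)
    ∀ᵇ-sound f t true  = proj₂ (Equivalence.to T-∧ t)

    Resolved : Profile → Set
    Resolved p = Overfull p ⊎ ∃ λ σ → Search.search (roles p) ≡ just σ

    resolved? : ∀ p → Dec (Resolved p)
    resolved? p = Any.any? (_≼? p) shapes ⊎-dec is-just? (Search.search (roles p))
      where
        is-just? : ∀ (m : Maybe Placement) → Dec (∃ λ σ → m ≡ just σ)
        is-just? (just σ) = yes (σ , refl)
        is-just? nothing  = no λ { (_ , ()) }

    check : ∀ nR nD nB a c → Bool
    check nR nD nB a c = does (resolved? (profile nR nD nB a c))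

    -- by evaluation over all 256 profiles
    checked : T (∀ᶠ λ nR → ∀ᶠ λ nD → ∀ᶠ λ nB → ∀ᵇ λ a → ∀ᵇ (check nR nD nB a))
    checked = _

    from-does : ∀ {A : Set} (a? : Dec A) → T (does a?) → A
    from-does (yes a) _ = a

    all-resolved : ∀ nR nD nB a c → Resolved (profile nR nD nB a c)
    all-resolved nR nD nB a c =
      from-does (resolved? _) (∀ᵇ-sound (check nR nD nB a) (∀ᵇ-sound (λ a → ∀ᵇ (check nR nD nB a))
                (∀ᶠ-sound (λ nB → ∀ᵇ λ a → ∀ᵇ (check nR nD nB a)) (∀ᶠ-sound (λ nD → ∀ᶠ λ nB → ∀ᵇ λ a → ∀ᵇ (check nR nD nB a))
                (∀ᶠ-sound (λ nR → ∀ᶠ λ nD → ∀ᶠ λ nB → ∀ᵇ λ a → ∀ᵇ (check nR nD nB a)) checked nR) nD) nB) a) c)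

  dichotomy : ∀ p → Overfull p ⊎ (¬ Overfull p × Cover (roles p) Endpoint)
  dichotomy p with Any.any? (_≼? p) shapes
  ... | yes over = inj₁ over
  ... | no ¬over with all-resolved (reds p) (dias p) (blues p) (has-e01 p) (has-e23 p)
  ...   | inj₁ over        = ⊥-elim (¬over over)
  ...   | inj₂ (_ , found) = inj₂ (¬over , Search.search-cover (roles p) found)

  ¬overfull⇒bounded : ∀ {p} → ¬ Overfull p → toℕ (reds p) ℕ.≤ 2 × toℕ (dias p) ℕ.≤ 2 × toℕ (blues p) ℕ.≤ 2
  ¬overfull⇒bounded ¬over =
    bound (λ 3≤ → ¬over (here (3≤ , ℕ.z≤n , ℕ.z≤n , (λ ()) , (λ ())))) ,
    bound (λ 3≤ → ¬over (there (here (ℕ.z≤n , 3≤ , ℕ.z≤n , (λ ()) , (λ ()))))) ,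
    bound (λ 3≤ → ¬over (there (there (here (ℕ.z≤n , ℕ.z≤n , 3≤ , (λ ()) , (λ ()))))))
    where
      bound : ∀ {n} → ¬ 3 ℕ.≤ n → n ℕ.≤ 2
      bound 3≰n = ℕ.≤-pred (ℕ.≰⇒> 3≰n)

module Realization {r d b : ℕ} (I : EdgeSet (Edge r d b))
                   (fR : Few (I ∘ red)) (fD : Few (I ∘ dia)) (fB : Few (I ∘ blue)) where

  open RoleGraph
  open Embedding (ends {1} {3} {1}) (ends {r} {d} {b})
  open Bicircular (ends {1} {3} {1}) using (Endpoint)

  profileᴵ : Profile
  profileᴵ = profile (count fR) (count fD) (count fB) (I e01) (I e23)

  realize : Role → Edge r d b
  realize (red k)  = Maybe.maybe red e01 (members fR k)
  realize (dia k)  = Maybe.maybe dia e01 (members fD k)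
  realize (blue k) = Maybe.maybe blue e01 (members fB k)
  realize e01      = e01
  realize e23      = e23

  unrealize : Edge r d b → Role
  unrealize (red i)  = red (index fR i)
  unrealize (dia i)  = dia (index fD i)
  unrealize (blue i) = blue (index fB i)
  unrealize e01      = e01
  unrealize e23      = e23

  private
    present : ∀ {m} {P : Fin m → Bool} (f : Few P) {k : Fin 3} →
              (toℕ k ℕ.<ᵇ toℕ (count f)) ≡ true → ∃ λ i → members f k ≡ just i
    present f {k} t = members-present f k (ℕ.<ᵇ⇒< _ _ (Equivalence.from T-≡ t))

    realized : ∀ {ρ} → roles profileᴵ ρ ≡ true →
               I (realize ρ) ≡ true × ends (realize ρ) ≡ ends ρ × unrealize (realize ρ) ≡ ρ
    realized {red k} p with present fR p
    ... | i , mk rewrite mk = members-in fR mk , refl , cong red (index-members fR mk)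
    realized {dia k} p with present fD p
    ... | i , mk rewrite mk = members-in fD mk , refl , cong dia (index-members fD mk)
    realized {blue k} p with present fB p
    ... | i , mk rewrite mk = members-in fB mk , refl , cong blue (index-members fB mk)
    realized {e01} p = p , refl , refl
    realized {e23} p = p , refl , refl

  realization : roles profileᴵ ↪ I
  realization = record
    { map = realize
    ; map-in = λ {ρ} p → proj₁ (realized {ρ} p)
    ; map-ends = λ {ρ} p → proj₁ (proj₂ (realized {ρ} p))
    ; map-injective = λ p p' eq → trans (sym (proj₂ (proj₂ (realized p))))
                                        (trans (cong unrealize eq) (proj₂ (proj₂ (realized p')))) }

  realization-onto : toℕ (count fR) ℕ.≤ 2 → toℕ (count fD) ℕ.≤ 2 → toℕ (count fB) ℕ.≤ 2 →
                     ∀ {e} → I e ≡ true → ∃ λ ρ → roles profileᴵ ρ ≡ true × realize ρ ≡ e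
  realization-onto r≤ d≤ b≤ {red i} p with members-complete fR r≤ p
  ... | k , k< , mk = red k , Equivalence.to T-≡ (ℕ.<⇒<ᵇ k<) , cong (Maybe.maybe red e01) mk
  realization-onto r≤ d≤ b≤ {dia i} p with members-complete fD d≤ p
  ... | k , k< , mk = dia k , Equivalence.to T-≡ (ℕ.<⇒<ᵇ k<) , cong (Maybe.maybe dia e01) mk
  realization-onto r≤ d≤ b≤ {blue i} p with members-complete fB b≤ p
  ... | k , k< , mk = blue k , Equivalence.to T-≡ (ℕ.<⇒<ᵇ k<) , cong (Maybe.maybe blue e01) mk
  realization-onto r≤ d≤ b≤ {e01} p = e01 , p , refl
  realization-onto r≤ d≤ b≤ {e23} p = e23 , p , refl

  star-cover : Graph.BicircularIndep ends I → G₁.StarCover r d b I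
  star-cover bic = [ overfull , orientable ] (dichotomy profileᴵ)
    where
      overfull : Overfull profileᴵ → G₁.StarCover r d b I
      overfull over = let dependent , q≼ = lookupAny shapes-dependent over in
        ⊥-elim (dependent (bicircular-reflect (restrict realization λ {ρ} → ≼⇒⊆ q≼ {ρ}) bic))

      orientable : ¬ Overfull profileᴵ × Cover (roles profileᴵ) Endpoint → G₁.StarCover r d b I
      orientable (¬over , cover) = let r≤ , d≤ , b≤ = ¬overfull⇒bounded ¬over in
        push-cover realization (realization-onto r≤ d≤ b≤) cover

bicircular⇒star-cover : ∀ {r d b} {I : EdgeSet (Edge r d b)} → Graph.BicircularIndep ends I → G₁.StarCover r d b I
bicircular⇒star-cover {I = I} = Realization.star-cover I (few (I ∘ red)) (few (I ∘ dia)) (few (I ∘ blue))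

module _ (r d b : ℕ) where

  open G₁ r d b
  open Bicircular (ends {r} {d} {b}) using (orientation⇒bicircular)

  bicircular⇔transversal : ∀ I → Graph.BicircularIndep ends I ⇔ TransversalIndep I
  bicircular⇔transversal I = mk⇔
    (cover⇒matching ∘ star⇒interval ∘ bicircular⇒star-cover)
    (orientation⇒bicircular ∘ cover⇒matching ∘ interval⇒star ∘ matching⇒cover edge-at edge-at-onto F._≟_)
    where
      edge-at-onto : ∀ e → ∃ λ p → edge-at p ≡ e
      edge-at-onto e = position e , edge-at-position e

lemma13 : (r d b : ℕ) → LatticePathWithRedMinBlueMax r d b
lemma13 r d b = order , 4 , lo , hi , valid-presentation , bicircular⇔transversal r d b , minimum-red , maximum-blue
  where open G₁ r d b
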